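{- Let $\underline{D}$ be a double Boolean algebra, $a,b,c\in D$, $I$ an ideal of the Boolean algebra $\underline{D}_\sqcap$ and $F$ a filter of the Boolean algebra $\underline{D}_\sqcup$. Then: (1) $a+b\in D_\sqcap$ and $a\cdot b\in D_\sqcup$; (2) $a+b=b+a$ and $a\cdot b=b\cdot a$; (3) $a+a=\bot$ and $a\cdot a=\top$; (4) $a+\bot=a\sqcap a$ and $a\cdot\top=a\sqcup a$; (5) $a+\top=\neg a$ and $a\cdot\bot=\lrcorner a$; (6) $a,b\in I\Rightarrow a+b\in I$, and $a,b\in F\Rightarrow a\cdot b\in F$; (7) $a+(b\sqcap b)=a+b$ and $a\cdot(b\sqcup b)=a\cdot b$; (8) $(a\sqcap a)+(b\sqcap b)=a+b$ and $(a\sqcup a)\cdot(b\sqcup b)=a\cdot b$; (9) $(a+b)+c=a+(b+c)$ and $(a\cdot b)\cdot c=a\cdot(b\cdot c)$; (10) if $\underline{D}$ is regular, then ($a+b=\bot$ and $a\cdot b=\top$) if and only if $a=b$.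
   Context: A double Boolean algebra (dBa) is an algebra $\underline{D}=(D;\sqcap,\sqcup,\neg,\lrcorner,\bot,\top)$ of type $(2,2,1,1,0,0)$ satisfying, for all $x,y,z$, where $x\vee y:=\neg(\neg x\sqcap\neg y)$ and $x\wedge y:=\lrcorner(\lrcorner x\sqcup\lrcorner y)$: $(x\sqcap x)\sqcap y=x\sqcap y$; $(x\sqcup x)\sqcup y=x\sqcup y$; $\sqcap$ and $\sqcup$ are commutative and associative; $x\sqcap(x\sqcup y)=x\sqcap x$; $x\sqcup(x\sqcap y)=x\sqcup x$; $x\sqcap(x\vee y)=x\sqcap x$; $x\sqcup(x\wedge y)=x\sqcup x$; $x\sqcap(y\vee z)=(x\sqcap y)\vee(x\sqcap z)$; $x\sqcup(y\wedge z)=(x\sqcup y)\wedge(x\sqcup z)$; $\neg\neg(x\sqcap y)=x\sqcap y$; $\lrcorner\lrcorner(x\sqcup y)=x\sqcup y$; $\neg(x\sqcap x)=\neg x$; $\lrcorner(x\sqcup x)=\lrcorner x$; $x\sqcap\neg x=\bot$; $x\sqcup\lrcorner x=\top$; $\neg\bot=\top\sqcap\top$; $\lrcorner\top=\bot\sqcup\bot$; $\neg\top=\bot$; $\lrcorner\bot=\top$; $(x\sqcap x)\sqcup(x\sqcap x)=(x\sqcup x)\sqcap(x\sqcup x)$. $D_\sqcap=\{x: x\sqcap x=x\}$, $D_\sqcup=\{x: x\sqcup x=x\}$; it is known that $\underline{D}_\sqcap=(D_\sqcap;\sqcap,\vee,\neg,\bot,\neg\bot)$ and $\underline{D}_\sqcup=(D_\sqcup;\wedge,\sqcup,\lrcorner,\lrcorner\top,\top)$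 are Boolean algebras. Define $x+y:=(x\sqcap\neg y)\vee(\neg x\sqcap y)$ and $x\cdot y:=(x\sqcup\lrcorner y)\wedge(\lrcorner x\sqcup y)$. The quasi-order is $x\sqsubseteq y$ iff $x\sqcap y=x\sqcap x$ and $x\sqcup y=y\sqcup y$; $\underline{D}$ is regular if $\sqsubseteq$ is antisymmetric. -}

module Defs where

open import Level using (Level) renaming (suc to lsuc; _⊔_ to _⊔ˡ_)
open import Relation.Binary.PropositionalEquality using (_≡_)
open import Data.Product using (_×_)

record DBA (c : Level) : Set (lsuc c) where
  infixr 7 _⊓_
  infixr 6 _⊔_
  field
    Carrier : Set c
    _⊓_ _⊔_ : Carrier → Carrier → Carrier
    ¬_ ⌟_ : Carrier → Carrier
    ⊥ ⊤ : Carrier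

  _∨_ : Carrier → Carrier → Carrier
  x ∨ y = ¬ (¬ x ⊓ ¬ y)

  _∧_ : Carrier → Carrier → Carrier
  x ∧ y = ⌟ (⌟ x ⊔ ⌟ y)

  field
    ⊓-idem-l : ∀ x y → (x ⊓ x) ⊓ y ≡ x ⊓ y
    ⊔-idem-l : ∀ x y → (x ⊔ x) ⊔ y ≡ x ⊔ y
    ⊓-comm : ∀ x y → x ⊓ y ≡ y ⊓ x
    ⊔-comm : ∀ x y → x ⊔ y ≡ y ⊔ x
    ⊓-assoc : ∀ x y z → x ⊓ (y ⊓ z) ≡ (x ⊓ y) ⊓ z
    ⊔-assoc : ∀ x y z → x ⊔ (y ⊔ z) ≡ (x ⊔ y) ⊔ z
    ⊓-abs-⊔ : ∀ x y → x ⊓ (x ⊔ y) ≡ x ⊓ x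
    ⊔-abs-⊓ : ∀ x y → x ⊔ (x ⊓ y) ≡ x ⊔ x
    ⊓-abs-∨ : ∀ x y → x ⊓ (x ∨ y) ≡ x ⊓ x
    ⊔-abs-∧ : ∀ x y → x ⊔ (x ∧ y) ≡ x ⊔ x
    ⊓-distrib-∨ : ∀ x y z → x ⊓ (y ∨ z) ≡ (x ⊓ y) ∨ (x ⊓ z)
    ⊔-distrib-∧ : ∀ x y z → x ⊔ (y ∧ z) ≡ (x ⊔ y) ∧ (x ⊔ z)
    ¬¬-⊓ : ∀ x y → ¬ ¬ (x ⊓ y) ≡ x ⊓ y
    ⌟⌟-⊔ : ∀ x y → ⌟ ⌟ (x ⊔ y) ≡ x ⊔ y
    ¬-⊓-idem : ∀ x → ¬ (x ⊓ x) ≡ ¬ x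
    ⌟-⊔-idem : ∀ x → ⌟ (x ⊔ x) ≡ ⌟ x
    ⊓-compl : ∀ x → x ⊓ ¬ x ≡ ⊥
    ⊔-compl : ∀ x → x ⊔ ⌟ x ≡ ⊤
    ¬⊥ : ¬ ⊥ ≡ ⊤ ⊓ ⊤
    ⌟⊤ : ⌟ ⊤ ≡ ⊥ ⊔ ⊥
    ¬⊤ : ¬ ⊤ ≡ ⊥
    ⌟⊥ : ⌟ ⊥ ≡ ⊤
    mixed : ∀ x → (x ⊓ x) ⊔ (x ⊓ x) ≡ (x ⊔ x) ⊓ (x ⊔ x)

  infixl 6 _+_
  infixl 7 _·_

  _+_ : Carrier → Carrier → Carrier
  x + y = (x ⊓ ¬ y) ∨ (¬ x ⊓ y)

  _·_ : Carrier → Carrier → Carrier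
  x · y = (x ⊔ ⌟ y) ∧ (⌟ x ⊔ y)

  D⊓ : Carrier → Set c
  D⊓ x = x ⊓ x ≡ x

  D⊔ : Carrier → Set c
  D⊔ x = x ⊔ x ≡ x

  _⊑_ : Carrier → Carrier → Set c
  x ⊑ y = (x ⊓ y ≡ x ⊓ x) × (x ⊔ y ≡ y ⊔ y)

  Regular : Set c
  Regular = ∀ x y → x ⊑ y → y ⊑ x → x ≡ y

  -- An ideal of the Boolean algebra D_⊓ = (D_⊓; ⊓, ∨, ¬, ⊥, ¬⊥):
  -- a subset of D_⊓ containing ⊥, closed under ∨, and downward closed
  -- for the order x ≤ y ⇔ x ⊓ y = x of D_⊓.
  record IsIdeal⊓ {ℓ : Level} (I : Carrier → Set ℓ) : Set (c ⊔ˡ ℓ) where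
    field
      ⊆D⊓ : ∀ {x} → I x → D⊓ x
      ⊥∈ : I ⊥
      ∨-closed : ∀ {x y} → I x → I y → I (x ∨ y)
      down-closed : ∀ {x y} → D⊓ x → I y → x ⊓ y ≡ x → I x

  -- A filter of the Boolean algebra D_⊔ = (D_⊔; ∧, ⊔, ⌟, ⌟⊤, ⊤):
  -- a subset of D_⊔ containing ⊤, closed under ∧, and upward closed
  -- for the order x ≤ y ⇔ x ⊔ y = y of D_⊔.
  record IsFilter⊔ {ℓ : Level} (F : Carrier → Set ℓ) : Set (c ⊔ˡ ℓ) where
    field
      ⊆D⊔ : ∀ {x} → F x → D⊔ x
      ⊤∈ : F ⊤
      ∧-closed : ∀ {x y} → F x → F y → F (x ∧ y)
      up-closed : ∀ {x y} → D⊔ y → F x → x ⊔ y ≡ y → F y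

{-# OPTIONS --safe #-}
module Submission where

-- Identify x with x ⊓ x. Modulo this identification (D; ⊓, ∨, ¬, ⊥, ¬ ⊥) satisfies
-- the Boolean algebra laws, and x + y is its symmetric difference, so the Boolean
-- ring laws hold for + up to the identification. Since every value of + already
-- lies in D⊓, where the identification is equality, they hold on the nose. The
-- statements about · are the same statements in the dual dBa (swap ⊓/⊔, ¬/⌟,
-- ⊥/⊤), and in a regular dBa, a + b = ⊥ and a · b = ⊤ give a ⊓ a = b ⊓ b and
-- a ⊔ a = b ⊔ b, hence a ⊑ b ⊑ a.

open import Defs
open import Level using (Level)
open import Relation.Binary.PropositionalEquality
  using (_≡_; refl; sym; trans; cong; cong₂; subst; module ≡-Reasoning)
open import Data.Product using (_×_; _,_)
open import Function.Bundles using (_⇔_; mk⇔)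
open import Algebra.Bundles using (CommutativeRing)
open import Algebra.Lattice.Bundles using (BooleanAlgebra)

module BooleanReduct {c : Level} (𝔻 : DBA c) where
  open DBA 𝔻
  open ≡-Reasoning

  ⊓-idemʳ : ∀ x y → x ⊓ (y ⊓ y) ≡ x ⊓ y
  ⊓-idemʳ x y = begin
    x ⊓ (y ⊓ y) ≡⟨ ⊓-comm x (y ⊓ y) ⟩
    (y ⊓ y) ⊓ x ≡⟨ ⊓-idem-l y x ⟩
    y ⊓ x       ≡⟨ ⊓-comm y x ⟩
    x ⊓ y       ∎

  ⊓-of-squares : ∀ x y → (x ⊓ x) ⊓ (y ⊓ y) ≡ x ⊓ y
  ⊓-of-squares x y = trans (⊓-idem-l x (y ⊓ y)) (⊓-idemʳ x y)

  ⊓-lowerʳ : ∀ x y → (x ⊓ y) ⊓ y ≡ x ⊓ y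
  ⊓-lowerʳ x y = trans (sym (⊓-assoc x y y)) (⊓-idemʳ x y)

  ⊓-lowerˡ : ∀ x y → (x ⊓ y) ⊓ x ≡ x ⊓ y
  ⊓-lowerˡ x y = begin
    (x ⊓ y) ⊓ x ≡⟨ cong (_⊓ x) (⊓-comm x y) ⟩
    (y ⊓ x) ⊓ x ≡⟨ ⊓-lowerʳ y x ⟩
    y ⊓ x       ≡⟨ ⊓-comm y x ⟩
    x ⊓ y       ∎

  ¬-∈D⊓ : ∀ x → D⊓ (¬ x)
  ¬-∈D⊓ x = begin
    ¬ x ⊓ ¬ x         ≡⟨ sym (¬¬-⊓ (¬ x) (¬ x)) ⟩
    ¬ ¬ (¬ x ⊓ ¬ x)   ≡⟨ cong ¬_ (¬-⊓-idem (¬ x)) ⟩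
    ¬ ¬ ¬ x           ≡⟨ cong (λ t → ¬ ¬ t) (sym (¬-⊓-idem x)) ⟩
    ¬ ¬ ¬ (x ⊓ x)     ≡⟨ cong ¬_ (¬¬-⊓ x x) ⟩
    ¬ (x ⊓ x)         ≡⟨ ¬-⊓-idem x ⟩
    ¬ x               ∎

  ⊓-∈D⊓ : ∀ x y → D⊓ (x ⊓ y)
  ⊓-∈D⊓ x y = subst D⊓ (¬¬-⊓ x y) (¬-∈D⊓ (¬ (x ⊓ y)))

  ⊥-∈D⊓ : D⊓ ⊥
  ⊥-∈D⊓ = subst D⊓ (⊓-compl ⊥) (⊓-∈D⊓ ⊥ (¬ ⊥))

  ¬¬x≡x⊓x : ∀ x → ¬ ¬ x ≡ x ⊓ x
  ¬¬x≡x⊓x x = trans (cong ¬_ (sym (¬-⊓-idem x))) (¬¬-⊓ x x)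

  infix 4 _≈_
  _≈_ : Carrier → Carrier → Set c
  x ≈ y = x ⊓ x ≡ y ⊓ y

  ≡⇒≈ : ∀ {x y} → x ≡ y → x ≈ y
  ≡⇒≈ = cong (λ t → t ⊓ t)

  D⊓-≈⇒≡ : ∀ {x y} → D⊓ x → D⊓ y → x ≈ y → x ≡ y
  D⊓-≈⇒≡ x∈D⊓ y∈D⊓ x≈y = trans (sym x∈D⊓) (trans x≈y y∈D⊓)

  ⊤≈¬⊥ : ⊤ ≈ ¬ ⊥
  ⊤≈¬⊥ = sym (trans (¬-∈D⊓ ⊥) ¬⊥)

  ⊓-idem-≈ : ∀ x → x ⊓ x ≈ x
  ⊓-idem-≈ x = ⊓-∈D⊓ x x

  ⊓-cong-≈ : ∀ {x x′ y y′} → x ≈ x′ → y ≈ y′ → x ⊓ y ≡ x′ ⊓ y′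
  ⊓-cong-≈ {x} {x′} {y} {y′} x≈x′ y≈y′ = begin
    x ⊓ y                 ≡⟨ sym (⊓-of-squares x y) ⟩
    (x ⊓ x) ⊓ (y ⊓ y)     ≡⟨ cong₂ _⊓_ x≈x′ y≈y′ ⟩
    (x′ ⊓ x′) ⊓ (y′ ⊓ y′) ≡⟨ ⊓-of-squares x′ y′ ⟩
    x′ ⊓ y′               ∎

  ¬-cong-≈ : ∀ {x y} → x ≈ y → ¬ x ≡ ¬ y
  ¬-cong-≈ {x} {y} x≈y = begin
    ¬ x       ≡⟨ sym (¬-⊓-idem x) ⟩
    ¬ (x ⊓ x) ≡⟨ cong ¬_ x≈y ⟩
    ¬ (y ⊓ y) ≡⟨ ¬-⊓-idem y ⟩
    ¬ y       ∎

  ¬-distrib-⊓ : ∀ x y → ¬ (x ⊓ y) ≡ (¬ x) ∨ (¬ y)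
  ¬-distrib-⊓ x y = cong ¬_ (begin
    x ⊓ y             ≡⟨ sym (⊓-of-squares x y) ⟩
    (x ⊓ x) ⊓ (y ⊓ y) ≡⟨ sym (cong₂ _⊓_ (¬¬x≡x⊓x x) (¬¬x≡x⊓x y)) ⟩
    ¬ ¬ x ⊓ ¬ ¬ y     ∎)

  ∨-comm : ∀ x y → x ∨ y ≡ y ∨ x
  ∨-comm x y = cong ¬_ (⊓-comm (¬ x) (¬ y))

  ∨-assoc : ∀ x y z → (x ∨ y) ∨ z ≡ x ∨ (y ∨ z)
  ∨-assoc x y z = begin
    ¬ (¬ ¬ (¬ x ⊓ ¬ y) ⊓ ¬ z) ≡⟨ cong (λ t → ¬ (t ⊓ ¬ z)) (¬¬-⊓ (¬ x) (¬ y)) ⟩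
    ¬ ((¬ x ⊓ ¬ y) ⊓ ¬ z)     ≡⟨ cong ¬_ (sym (⊓-assoc (¬ x) (¬ y) (¬ z))) ⟩
    ¬ (¬ x ⊓ (¬ y ⊓ ¬ z))     ≡⟨ cong (λ t → ¬ (¬ x ⊓ t)) (sym (¬¬-⊓ (¬ y) (¬ z))) ⟩
    ¬ (¬ x ⊓ ¬ ¬ (¬ y ⊓ ¬ z)) ∎

  ∨-absorbs-⊓ : ∀ x y → x ∨ (x ⊓ y) ≡ x ⊓ x
  ∨-absorbs-⊓ x y = begin
    ¬ (¬ x ⊓ ¬ (x ⊓ y))   ≡⟨ cong (λ t → ¬ (¬ x ⊓ t)) (¬-distrib-⊓ x y) ⟩
    ¬ (¬ x ⊓ ((¬ x) ∨ (¬ y))) ≡⟨ cong ¬_ (⊓-abs-∨ (¬ x) (¬ y)) ⟩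
    ¬ (¬ x ⊓ ¬ x)         ≡⟨ ¬-⊓-idem (¬ x) ⟩
    ¬ ¬ x                 ≡⟨ ¬¬x≡x⊓x x ⟩
    x ⊓ x                 ∎

  ∨-distribˡ-⊓ : ∀ x y z → x ∨ (y ⊓ z) ≡ (x ∨ y) ⊓ (x ∨ z)
  ∨-distribˡ-⊓ x y z = begin
    ¬ (¬ x ⊓ ¬ (y ⊓ z))       ≡⟨ cong (λ t → ¬ (¬ x ⊓ t)) (¬-distrib-⊓ y z) ⟩
    ¬ (¬ x ⊓ ((¬ y) ∨ (¬ z)))     ≡⟨ cong ¬_ (⊓-distrib-∨ (¬ x) (¬ y) (¬ z)) ⟩
    ¬ ¬ ((x ∨ y) ⊓ (x ∨ z))   ≡⟨ ¬¬-⊓ (x ∨ y) (x ∨ z) ⟩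
    (x ∨ y) ⊓ (x ∨ z)         ∎

  ∨-complementʳ : ∀ x → x ∨ (¬ x) ≡ ¬ ⊥
  ∨-complementʳ x = cong ¬_ (begin
    ¬ x ⊓ ¬ ¬ x   ≡⟨ cong (¬ x ⊓_) (¬¬x≡x⊓x x) ⟩
    ¬ x ⊓ (x ⊓ x) ≡⟨ ⊓-idemʳ (¬ x) x ⟩
    ¬ x ⊓ x       ≡⟨ ⊓-comm (¬ x) x ⟩
    x ⊓ ¬ x       ≡⟨ ⊓-compl x ⟩
    ⊥             ∎)

  ⊓-booleanAlgebra : BooleanAlgebra c c
  ⊓-booleanAlgebra = record
    { Carrier = Carrier ; _≈_ = _≈_ ; _∨_ = _∨_ ; _∧_ = _⊓_ ; ¬_ = ¬_ ; ⊤ = ¬ ⊥ ; ⊥ = ⊥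
    ; isBooleanAlgebra = record
      { isDistributiveLattice = record
        { isLattice = record
          { isEquivalence = record { refl = refl ; sym = sym ; trans = trans }
          ; ∨-comm = λ x y → ≡⇒≈ (∨-comm x y)
          ; ∨-assoc = λ x y z → ≡⇒≈ (∨-assoc x y z)
          ; ∨-cong = λ x≈x′ y≈y′ →
              ≡⇒≈ (cong ¬_ (⊓-cong-≈ (≡⇒≈ (¬-cong-≈ x≈x′)) (≡⇒≈ (¬-cong-≈ y≈y′))))
          ; ∧-comm = λ x y → ≡⇒≈ (⊓-comm x y)
          ; ∧-assoc = λ x y z → ≡⇒≈ (sym (⊓-assoc x y z))
          ; ∧-cong = λ x≈x′ y≈y′ → ≡⇒≈ (⊓-cong-≈ x≈x′ y≈y′)
          ; absorptive = (λ x y → trans (≡⇒≈ (∨-absorbs-⊓ x y)) (⊓-idem-≈ x))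
                       , (λ x y → trans (≡⇒≈ (⊓-abs-∨ x y)) (⊓-idem-≈ x))
          }
        ; ∨-distrib-∧ = (λ x y z → ≡⇒≈ (∨-distribˡ-⊓ x y z))
                      , (λ x y z → ≡⇒≈ (begin
                           (y ⊓ z) ∨ x       ≡⟨ ∨-comm (y ⊓ z) x ⟩
                           x ∨ (y ⊓ z)       ≡⟨ ∨-distribˡ-⊓ x y z ⟩
                           (x ∨ y) ⊓ (x ∨ z) ≡⟨ cong₂ _⊓_ (∨-comm x y) (∨-comm x z) ⟩
                           (y ∨ x) ⊓ (z ∨ x) ∎))
        ; ∧-distrib-∨ = (λ x y z → ≡⇒≈ (⊓-distrib-∨ x y z))
                      , (λ x y z → ≡⇒≈ (begin
                           (y ∨ z) ⊓ x       ≡⟨ ⊓-comm (y ∨ z) x ⟩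
                           x ⊓ (y ∨ z)       ≡⟨ ⊓-distrib-∨ x y z ⟩
                           (x ⊓ y) ∨ (x ⊓ z) ≡⟨ cong₂ _∨_ (⊓-comm x y) (⊓-comm x z) ⟩
                           (y ⊓ x) ∨ (z ⊓ x) ∎))
        }
      ; ∨-complement = (λ x → ≡⇒≈ (trans (∨-comm (¬ x) x) (∨-complementʳ x)))
                     , (λ x → ≡⇒≈ (∨-complementʳ x))
      ; ∧-complement = (λ x → ≡⇒≈ (trans (⊓-comm (¬ x) x) (⊓-compl x)))
                     , (λ x → ≡⇒≈ (⊓-compl x))
      ; ¬-cong = λ x≈y → ≡⇒≈ (¬-cong-≈ x≈y)
      }
    }

module SymmetricDifference {c : Level} (𝔻 : DBA c) where
  open DBA 𝔻
  open BooleanReduct 𝔻 public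
  private module B = BooleanAlgebra ⊓-booleanAlgebra
  open import Algebra.Lattice.Properties.BooleanAlgebra ⊓-booleanAlgebra
    using (deMorgan₁; ∨-identityˡ; module XorRing)
  open import Relation.Binary.Reasoning.Setoid B.setoid

  ∨-⊓-¬ˡ : ∀ x y → (x ∨ y) ⊓ ¬ x ≈ y ⊓ ¬ x
  ∨-⊓-¬ˡ x y = begin
    (x ∨ y) ⊓ ¬ x           ≈⟨ B.∧-distribʳ-∨ (¬ x) x y ⟩
    (x ⊓ ¬ x) ∨ (y ⊓ ¬ x)   ≈⟨ B.∨-congʳ (B.∧-complementʳ x) ⟩
    ⊥ ∨ (y ⊓ ¬ x)           ≈⟨ ∨-identityˡ (y ⊓ ¬ x) ⟩
    y ⊓ ¬ x                 ∎

  +-xor : ∀ x y → x + y ≈ (x ∨ y) ⊓ ¬ (x ⊓ y)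
  +-xor x y = B.sym (begin
    (x ∨ y) ⊓ ¬ (x ⊓ y)                ≈⟨ B.∧-congˡ (deMorgan₁ x y) ⟩
    (x ∨ y) ⊓ ((¬ x) ∨ (¬ y))          ≈⟨ B.∧-distribˡ-∨ (x ∨ y) (¬ x) (¬ y) ⟩
    ((x ∨ y) ⊓ ¬ x) ∨ ((x ∨ y) ⊓ ¬ y)  ≈⟨ B.∨-cong (∨-⊓-¬ˡ x y) x∨y⊓¬y≈x⊓¬y ⟩
    (y ⊓ ¬ x) ∨ (x ⊓ ¬ y)              ≈⟨ B.∨-comm (y ⊓ ¬ x) (x ⊓ ¬ y) ⟩
    (x ⊓ ¬ y) ∨ (y ⊓ ¬ x)              ≈⟨ B.∨-congˡ (B.∧-comm y (¬ x)) ⟩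
    (x ⊓ ¬ y) ∨ (¬ x ⊓ y)              ∎)
    where
    x∨y⊓¬y≈x⊓¬y : (x ∨ y) ⊓ ¬ y ≈ x ⊓ ¬ y
    x∨y⊓¬y≈x⊓¬y = B.trans (B.∧-congʳ (B.∨-comm x y)) (∨-⊓-¬ˡ y x)

  open XorRing _+_ +-xor
  open import Algebra.Properties.Group (CommutativeRing.+-group ⊕-∧-commutativeRing)
    using (x∙y⁻¹≈ε⇒x≈y)

  +-∈D⊓ : ∀ x y → D⊓ (x + y)
  +-∈D⊓ x y = ¬-∈D⊓ ((¬ (x ⊓ ¬ y)) ⊓ ¬ (¬ x ⊓ y))

  +-≈⇒≡ : ∀ {x y u v} → x + y ≈ u + v → x + y ≡ u + v
  +-≈⇒≡ {x} {y} {u} {v} = D⊓-≈⇒≡ (+-∈D⊓ x y) (+-∈D⊓ u v)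

  +-comm : ∀ x y → x + y ≡ y + x
  +-comm x y = +-≈⇒≡ (⊕-comm x y)

  +-assoc : ∀ x y z → (x + y) + z ≡ x + (y + z)
  +-assoc x y z = +-≈⇒≡ (⊕-assoc x y z)

  +-cong-≈ : ∀ {x x′ y y′} → x ≈ x′ → y ≈ y′ → x + y ≡ x′ + y′
  +-cong-≈ x≈x′ y≈y′ = +-≈⇒≡ (⊕-cong x≈x′ y≈y′)

  x+x≡⊥ : ∀ x → x + x ≡ ⊥
  x+x≡⊥ x = D⊓-≈⇒≡ (+-∈D⊓ x x) ⊥-∈D⊓ (⊕-inverseˡ x)

  +-identityʳ : ∀ x → x + ⊥ ≡ x ⊓ x
  +-identityʳ x = trans (sym (+-∈D⊓ x ⊥)) (⊕-identityʳ x)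

  x+⊤≡¬x : ∀ x → x + ⊤ ≡ ¬ x
  x+⊤≡¬x x = D⊓-≈⇒≡ (+-∈D⊓ x ⊤) (¬-∈D⊓ x) (begin
    x + ⊤       ≈⟨ ⊕-cong B.refl ⊤≈¬⊥ ⟩
    x + (¬ ⊥)   ≈⟨ ¬-distribʳ-⊕ x ⊥ ⟨
    ¬ (x + ⊥)   ≈⟨ B.¬-cong (⊕-identityʳ x) ⟩
    ¬ x         ∎)

  +≡⊥⇒≈ : ∀ {x y} → x + y ≡ ⊥ → x ≈ y
  +≡⊥⇒≈ {x} {y} x+y≡⊥ = x∙y⁻¹≈ε⇒x≈y x y (≡⇒≈ x+y≡⊥)

  +-closed : ∀ {ℓ} {I : Carrier → Set ℓ} → IsIdeal⊓ I → ∀ {x y} → I x → I y → I (x + y)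
  +-closed isIdeal {x} {y} x∈I y∈I =
    ∨-closed (down-closed (⊓-∈D⊓ x (¬ y)) x∈I (⊓-lowerˡ x (¬ y)))
             (down-closed (⊓-∈D⊓ (¬ x) y) y∈I (⊓-lowerʳ (¬ x) y))
    where open IsIdeal⊓ isIdeal

-- In the dual, + unfolds to · and D⊓ to D⊔.
dual : ∀ {c} → DBA c → DBA c
dual 𝔻 = record
  { Carrier = Carrier ; _⊓_ = _⊔_ ; _⊔_ = _⊓_ ; ¬_ = ⌟_ ; ⌟_ = ¬_ ; ⊥ = ⊤ ; ⊤ = ⊥
  ; ⊓-idem-l = ⊔-idem-l ; ⊔-idem-l = ⊓-idem-l ; ⊓-comm = ⊔-comm ; ⊔-comm = ⊓-comm
  ; ⊓-assoc = ⊔-assoc ; ⊔-assoc = ⊓-assoc ; ⊓-abs-⊔ = ⊔-abs-⊓ ; ⊔-abs-⊓ = ⊓-abs-⊔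
  ; ⊓-abs-∨ = ⊔-abs-∧ ; ⊔-abs-∧ = ⊓-abs-∨
  ; ⊓-distrib-∨ = ⊔-distrib-∧ ; ⊔-distrib-∧ = ⊓-distrib-∨
  ; ¬¬-⊓ = ⌟⌟-⊔ ; ⌟⌟-⊔ = ¬¬-⊓ ; ¬-⊓-idem = ⌟-⊔-idem ; ⌟-⊔-idem = ¬-⊓-idem
  ; ⊓-compl = ⊔-compl ; ⊔-compl = ⊓-compl ; ¬⊥ = ⌟⊤ ; ⌟⊤ = ¬⊥ ; ¬⊤ = ⌟⊥ ; ⌟⊥ = ¬⊤
  ; mixed = λ x → sym (mixed x)
  }
  where open DBA 𝔻

filter⇒dual-ideal : ∀ {c ℓ} (𝔻 : DBA c) {F : DBA.Carrier 𝔻 → Set ℓ} →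
                    DBA.IsFilter⊔ 𝔻 F → DBA.IsIdeal⊓ (dual 𝔻) F
filter⇒dual-ideal 𝔻 isFilter = record
  { ⊆D⊓ = ⊆D⊔
  ; ⊥∈ = ⊤∈
  ; ∨-closed = ∧-closed
  ; down-closed = λ {x} {y} x∈D⊔ y∈F y⊔x≡x → up-closed x∈D⊔ y∈F (trans (⊔-comm y x) y⊔x≡x)
  }
  where
  open DBA 𝔻
  open IsFilter⊔ isFilter

⊓-idem-≡-⊔-idem-≡⇒⊑ : ∀ {c} (𝔻 : DBA c) → let open DBA 𝔻 in
                      ∀ {x y} → x ⊓ x ≡ y ⊓ y → x ⊔ x ≡ y ⊔ y → x ⊑ y
⊓-idem-≡-⊔-idem-≡⇒⊑ 𝔻 x⊓x≡y⊓y x⊔x≡y⊔y =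
  SymmetricDifference.⊓-cong-≈ 𝔻 refl (sym x⊓x≡y⊓y) ,
  SymmetricDifference.⊓-cong-≈ (dual 𝔻) x⊔x≡y⊔y refl

proposition3p7 : ∀ {c ℓ₁ ℓ₂ : Level} (𝔻 : DBA c) → let open DBA 𝔻 in
    (a b d : Carrier) (I : Carrier → Set ℓ₁) (F : Carrier → Set ℓ₂) →
    IsIdeal⊓ I → IsFilter⊔ F →
    -- (1)
    (D⊓ (a + b) × D⊔ (a · b))
    -- (2)
    × ((a + b ≡ b + a) × (a · b ≡ b · a))
    -- (3)
    × ((a + a ≡ ⊥) × (a · a ≡ ⊤))
    -- (4)
    × ((a + ⊥ ≡ a ⊓ a) × (a · ⊤ ≡ a ⊔ a))
    -- (5)
    × ((a + ⊤ ≡ ¬ a) × (a · ⊥ ≡ ⌟ a))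
    -- (6)
    × ((I a → I b → I (a + b)) × (F a → F b → F (a · b)))
    -- (7)
    × ((a + (b ⊓ b) ≡ a + b) × (a · (b ⊔ b) ≡ a · b))
    -- (8)
    × (((a ⊓ a) + (b ⊓ b) ≡ a + b) × ((a ⊔ a) · (b ⊔ b) ≡ a · b))
    -- (9)
    × (((a + b) + d ≡ a + (b + d)) × ((a · b) · d ≡ a · (b · d)))
    -- (10)
    × (Regular → (((a + b ≡ ⊥) × (a · b ≡ ⊤)) ⇔ (a ≡ b)))
proposition3p7 𝔻 a b d I F isIdeal isFilter =
    (+.+-∈D⊓ a b , ·.+-∈D⊓ a b)
  , (+.+-comm a b , ·.+-comm a b)
  , (+.x+x≡⊥ a , ·.x+x≡⊥ a)
  , (+.+-identityʳ a , ·.+-identityʳ a)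
  , (+.x+⊤≡¬x a , ·.x+⊤≡¬x a)
  , (+.+-closed isIdeal , ·.+-closed (filter⇒dual-ideal 𝔻 isFilter))
  , (+.+-cong-≈ refl (+.⊓-idem-≈ b) , ·.+-cong-≈ refl (·.⊓-idem-≈ b))
  , ( +.+-cong-≈ (+.⊓-idem-≈ a) (+.⊓-idem-≈ b)
    , ·.+-cong-≈ (·.⊓-idem-≈ a) (·.⊓-idem-≈ b))
  , (+.+-assoc a b d , ·.+-assoc a b d)
  , λ regular → mk⇔
      (λ (a+b≡⊥ , a·b≡⊤) → let a≈b = +.+≡⊥⇒≈ a+b≡⊥ ; a≈⊔b = ·.+≡⊥⇒≈ a·b≡⊤ in
        regular a b (⊓-idem-≡-⊔-idem-≡⇒⊑ 𝔻 a≈b a≈⊔b)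
                    (⊓-idem-≡-⊔-idem-≡⇒⊑ 𝔻 (sym a≈b) (sym a≈⊔b)))
      (λ { refl → +.x+x≡⊥ a , ·.x+x≡⊥ a })
  where
  module + = SymmetricDifference 𝔻
  module · = SymmetricDifference (dual 𝔻)
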